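{- Let $D$ be a finite digraph. The avoidance class $\mathrm{Av}(D)$ in the class $\mathcal{D}$ of all finite digraphs, under the homomorphic image ordering, is well quasi-ordered if and only if $D$ is complete (i.e. $D\cong\overrightarrow{K}_n$ for some $n$), in which case $\mathrm{Av}(D)$ is finite.
   Context: A digraph is a finite set $D$ with a binary relation $E(D)\subseteq D\times D$ (no reflexivity assumption). The complete digraph $\overrightarrow{K}_n$ has vertices $\{1,\dots,n\}$ and all pairs $(i,j)$, $1\le i,j\le n$, including loops, as edges. A homomorphism maps edges to edges. Homomorphic image ordering: $A\preceq B$ iff there is a surjective homomorphism $B\to A$. $\mathrm{Av}(D)=\{E\in\mathcal{D}:D\not\preceq E\}$. Well quasi-ordered means: no infinite strictly decreasing sequence and no infinite antichain. -}

module Defs where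

import Data.Nat
open import Data.Nat using (ℕ)
open import Relation.Binary.PropositionalEquality using (_≢_)
open import Data.Fin using (Fin)
open import Data.Bool using (Bool; true)
open import Data.Product using (Σ; _×_; ∃; _,_)
open import Data.List using (List)
open import Data.List.Membership.Propositional using (_∈_)
open import Relation.Binary.PropositionalEquality using (_≡_)
open import Relation.Nullary using (¬_)

-- A finite digraph: vertex set Fin size, edge relation given as a Boolean
-- matrix (any finite digraph is isomorphic to one of these).
record Digraph : Set where
  constructor digraph
  field
    size : ℕ
    edge : Fin size → Fin size → Bool
open Digraph public

Edge : (D : Digraph) → Fin (size D) → Fin (size D) → Set
Edge D a b = edge D a b ≡ true

IsHom : (D E : Digraph) → (Fin (size D) → Fin (size E)) → Set
IsHom D E f = ∀ a b → Edge D a b → Edge E (f a) (f b)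

Surjective : {m n : ℕ} → (Fin m → Fin n) → Set
Surjective {m} {n} f = ∀ (y : Fin n) → Σ (Fin m) λ x → f x ≡ y

_⪯_ : Digraph → Digraph → Set
A ⪯ B = Σ (Fin (size B) → Fin (size A)) λ f → IsHom B A f × Surjective f

_≺_ : Digraph → Digraph → Set
A ≺ B = (A ⪯ B) × ¬ (B ⪯ A)

_≅_ : Digraph → Digraph → Set
D ≅ E = Σ (Fin (size D) → Fin (size E)) λ f →
        Σ (Fin (size E) → Fin (size D)) λ g →
        IsHom D E f × IsHom E D g ×
        (∀ x → g (f x) ≡ x) × (∀ y → f (g y) ≡ y)

-- Complete digraph K_n (all pairs, including loops, are edges).
K : ℕ → Digraph
K n = digraph n (λ _ _ → true)

IsComplete : Digraph → Set
IsComplete D = ∃ λ n → D ≅ K n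

Av : Digraph → Digraph → Set
Av D E = ¬ (D ⪯ E)

InfiniteDescending : (Digraph → Set) → Set
InfiniteDescending C =
  Σ (ℕ → Digraph) λ s → (∀ i → C (s i)) × (∀ i → s (Data.Nat.suc i) ≺ s i)

InfiniteAntichain : (Digraph → Set) → Set
InfiniteAntichain C =
  Σ (ℕ → Digraph) λ s → (∀ i → C (s i)) × (∀ i j → i ≢ j → ¬ (s i ⪯ s j))

IsWQO : (Digraph → Set) → Set
IsWQO C = ¬ InfiniteDescending C × ¬ InfiniteAntichain C

FiniteClass : (Digraph → Set) → Set
FiniteClass C = Σ (List Digraph) λ L → ∀ E → C E → Σ Digraph λ F → F ∈ L × (E ≅ F)

-- If D is complete, every digraph with at least |D| vertices maps onto D, so
-- Av(D) consists of the finitely many digraphs with fewer vertices, and a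
-- finite class is trivially well quasi-ordered.  Conversely, a missing edge
-- a → b of D yields an infinite antichain inside Av(D).  For a ≠ b take the
-- loopless complete digraphs: a surjection from a larger one onto a smaller
-- one identifies two adjacent vertices and so creates a loop.  For a missing
-- loop take the reflexive tournaments T m (m ≥ 5) with i → i+1 and i → j for
-- j ≤ i-2.  As T n is antisymmetric, a homomorphism T m → T n that identifies
-- u and v also identifies every x with x → u and v → x; starting from any
-- collision, which exists when n < m, this spreads to all of T m, so the
-- homomorphism is constant and not surjective.

module Submission where

open import Defs
open import Data.Nat using (ℕ; _≥_)
open import Data.Product using (_×_)
open import Function.Bundles using (_⇔_)

open import Data.Nat as ℕ
  using (zero; suc; _+_; _<_; _≤_; z≤n; s≤s; NonZero; >-nonZero)
import Data.Nat.Properties as ℕ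
open import Data.Nat.DivMod using (_mod_; m<n⇒m%n≡m)
open import Data.Fin as Fin using (Fin; toℕ; inject≤; _≟_)
import Data.Fin.Properties as Fin
open import Data.Bool using (Bool; true; false; not)
open import Data.Bool.Properties using (T-≡) renaming (_≟_ to _≟ᵇ_)
open import Data.Product using (Σ; ∃-syntax; _,_; proj₁; proj₂)
open import Data.Sum using (_⊎_; inj₁; inj₂)
open import Data.List using (List; []; _∷_; [_]; map; concatMap; upTo; cartesianProductWith; lookup)
import Data.List.Relation.Unary.Any as Any
open import Data.List.Relation.Unary.Any.Properties using (lookup-index)
open import Data.List.Membership.Propositional using (_∈_)
open import Data.List.Membership.Propositional.Properties
  using (∈-map⁺; ∈-concatMap⁺; ∈-upTo⁺; ∈-cartesianProductWith⁺)
import Data.Vec.Functional as Vector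
open import Function using (_∘_; id; mk⇔; Equivalence)
open import Relation.Binary.PropositionalEquality hiding ([_])
open import Relation.Binary.Definitions using (tri<; tri≈; tri>)
open import Relation.Nullary using (¬_; ¬?; does; yes; no; contradiction)
open import Relation.Nullary.Decidable using (Dec; _⊎-dec_; dec-true; dec-false; toWitness; isYes≗does; decidable-stable)

⪯-refl : ∀ A → A ⪯ A
⪯-refl A = id , (λ _ _ e → e) , (λ y → y , refl)

⪯-trans : ∀ {A B C} → A ⪯ B → B ⪯ C → A ⪯ C
⪯-trans (f , f-hom , f-surj) (g , g-hom , g-surj) =
  f ∘ g , (λ a b e → f-hom (g a) (g b) (g-hom a b e)) , surj
  where
  surj : Surjective (f ∘ g)
  surj z with y , refl ← f-surj z with x , refl ← g-surj y = x , refl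

≅⇒⪯ : ∀ {A B} → A ≅ B → A ⪯ B
≅⇒⪯ (f , g , _ , g-hom , g∘f , _) = g , g-hom , λ x → f x , g∘f x

≅⇒⪰ : ∀ {A B} → A ≅ B → B ⪯ A
≅⇒⪰ (f , g , f-hom , _ , _ , f∘g) = f , f-hom , λ y → g y , f∘g y

larger⇒⋠ : ∀ {A B} → size B < size A → ¬ (A ⪯ B)
larger⇒⋠ B<A (f , _ , f-surj) with i , j , i<j , eq ← Fin.pigeonhole B<A (proj₁ ∘ f-surj) =
  ℕ.<⇒≢ i<j (cong toℕ (begin
    i                       ≡⟨ proj₂ (f-surj i) ⟨
    f (proj₁ (f-surj i))    ≡⟨ cong f eq ⟩
    f (proj₁ (f-surj j))    ≡⟨ proj₂ (f-surj j) ⟩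
    j                       ∎))
  where open ≡-Reasoning

∈-index-injective : ∀ {A : Set} {L : List A} {x y} (p : x ∈ L) (q : y ∈ L) →
  Any.index p ≡ Any.index q → x ≡ y
∈-index-injective {L = L} p q eq =
  trans (lookup-index p) (trans (cong (lookup L) eq) (sym (lookup-index q)))

finite⇒equivalent-pair : ∀ {C} → FiniteClass C → (s : ℕ → Digraph) → (∀ i → C (s i)) →
  ∃[ i ] ∃[ j ] i < j × s i ⪯ s j × s j ⪯ s i
finite⇒equivalent-pair (L , classify) s s∈C =
  let i , j , i<j , same-index = Fin.pigeonhole (ℕ.n<1+n _) (Any.index ∘ member ∘ toℕ)
      same = ∈-index-injective (member (toℕ i)) (member (toℕ j)) same-index
  in toℕ i , toℕ j , i<j , representative⇒⪯ same , representative⇒⪯ (sym same)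
  where
  representative : ℕ → Digraph
  representative i = proj₁ (classify (s i) (s∈C i))

  member : ∀ i → representative i ∈ L
  member i = proj₁ (proj₂ (classify (s i) (s∈C i)))

  ≅representative : ∀ i → s i ≅ representative i
  ≅representative i = proj₂ (proj₂ (classify (s i) (s∈C i)))

  representative⇒⪯ : ∀ {i j} → representative i ≡ representative j → s i ⪯ s j
  representative⇒⪯ {i} {j} same = ⪯-trans {s i} {representative i} {s j} (≅⇒⪯ (≅representative i))
    (subst (_⪯ s j) (sym same) (≅⇒⪰ (≅representative j)))

descending⇒⪯ : (s : ℕ → Digraph) → (∀ i → s (suc i) ≺ s i) → ∀ {i j} → i ≤ j → s j ⪯ s i
descending⇒⪯ s desc i≤j = go (ℕ.≤⇒≤′ i≤j)
  where
  go : ∀ {i j} → i ℕ.≤′ j → s j ⪯ s i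
  go (ℕ.≤′-reflexive refl)  = ⪯-refl _
  go {i} (ℕ.≤′-step {j} i≤′j) = ⪯-trans {s (suc j)} {s j} {s i} (proj₁ (desc j)) (go i≤′j)

finite⇒wqo : ∀ {C} → FiniteClass C → IsWQO C
finite⇒wqo {C} fin = no-descending , no-antichain
  where
  no-descending : ¬ InfiniteDescending C
  no-descending (s , s∈C , desc) with i , j , i<j , i⪯j , _ ← finite⇒equivalent-pair fin s s∈C =
    proj₂ (desc i) (⪯-trans {s i} {s j} {s (suc i)} i⪯j (descending⇒⪯ s desc i<j))

  no-antichain : ¬ InfiniteAntichain C
  no-antichain (s , s∈C , anti) with i , j , i<j , i⪯j , _ ← finite⇒equivalent-pair fin s s∈C =
    anti i j (ℕ.<⇒≢ i<j) i⪯j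

functions : {A : Set} → List A → (k : ℕ) → List (Fin k → A)
functions xs zero    = [ (λ ()) ]
functions xs (suc k) = cartesianProductWith Vector._∷_ xs (functions xs k)

∈-functions : {A : Set} (xs : List A) (k : ℕ) (h : Fin k → A) → (∀ i → h i ∈ xs) →
  Σ (Fin k → A) λ g → g ∈ functions xs k × g ≗ h
∈-functions xs zero    h h∈xs = (λ ()) , Any.here refl , λ ()
∈-functions xs (suc k) h h∈xs
  with g , g∈ , g≗ ← ∈-functions xs k (h ∘ Fin.suc) (h∈xs ∘ Fin.suc) =
  h Fin.zero Vector.∷ g ,
  ∈-cartesianProductWith⁺ Vector._∷_ (h∈xs Fin.zero) g∈ ,
  λ { Fin.zero → refl ; (Fin.suc i) → g≗ i }

adjacencies : (k : ℕ) → List (Fin k → Fin k → Bool)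
adjacencies k = functions (functions (true ∷ false ∷ []) k) k

∈-adjacencies : ∀ k (e : Fin k → Fin k → Bool) →
  Σ (Fin k → Fin k → Bool) λ g → g ∈ adjacencies k × (∀ a b → g a b ≡ e a b)
∈-adjacencies k e =
  let g , g∈ , g≗rows = ∈-functions _ k (proj₁ ∘ row) (proj₁ ∘ proj₂ ∘ row)
  in g , g∈ , λ a b → trans (cong (λ r → r b) (g≗rows a)) (proj₂ (proj₂ (row a)) b)
  where
  bool-∈ : ∀ b → b ∈ true ∷ false ∷ []
  bool-∈ true  = Any.here refl
  bool-∈ false = Any.there (Any.here refl)

  row : ∀ a → Σ (Fin k → Bool) λ r → r ∈ functions (true ∷ false ∷ []) k × r ≗ e a
  row a = ∈-functions _ k (e a) (bool-∈ ∘ e a)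

digraphsBelow : ℕ → List Digraph
digraphsBelow n = concatMap (λ k → map (digraph k) (adjacencies k)) (upTo n)

≗-≅ : ∀ {k} {e e′ : Fin k → Fin k → Bool} → (∀ a b → e a b ≡ e′ a b) →
  digraph k e ≅ digraph k e′
≗-≅ e≗e′ = id , id , (λ a b → trans (sym (e≗e′ a b))) , (λ a b → trans (e≗e′ a b)) ,
  (λ _ → refl) , (λ _ → refl)

∈-digraphsBelow : ∀ {n} E → size E < n → Σ Digraph λ F → F ∈ digraphsBelow n × E ≅ F
∈-digraphsBelow (digraph k e) k<n with g , g∈ , g≗e ← ∈-adjacencies k e =
  digraph k g ,
  ∈-concatMap⁺ (λ k → map (digraph k) (adjacencies k))
    (Any.map (λ { refl → ∈-map⁺ (digraph k) g∈ }) (∈-upTo⁺ k<n)) ,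
  ≗-≅ (λ a b → sym (g≗e a b))

size-bounded⇒finite : ∀ {C} n → (∀ E → C E → size E < n) → FiniteClass C
size-bounded⇒finite n bounded = digraphsBelow n , λ E E∈C → ∈-digraphsBelow E (bounded E E∈C)

AllEdges : Digraph → Set
AllEdges D = ∀ a b → Edge D a b

complete⇒allEdges : ∀ {D} → IsComplete D → AllEdges D
complete⇒allEdges {D} (_ , f , g , _ , g-hom , g∘f , _) a b =
  subst₂ (Edge D) (g∘f a) (g∘f b) (g-hom (f a) (f b) refl)

allEdges⇒complete : ∀ {D} → AllEdges D → IsComplete D
allEdges⇒complete {D} all = size D , id , id , (λ _ _ _ → refl) , (λ a b _ → all a b) ,
  (λ _ → refl) , (λ _ → refl)

toℕ-mod : ∀ {k n} .{{_ : NonZero n}} → k < n → toℕ (k mod n) ≡ k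
toℕ-mod {k} {n} k<n = trans (Fin.toℕ-fromℕ< _) (m<n⇒m%n≡m k<n)

mod-toℕ : ∀ {n} .{{_ : NonZero n}} (i : Fin n) → toℕ i mod n ≡ i
mod-toℕ i = Fin.toℕ-injective (toℕ-mod (Fin.toℕ<n i))

mod-surjective : ∀ {m n} .{{_ : NonZero n}} → n ≤ m → Surjective {m} {n} (λ x → toℕ x mod n)
mod-surjective {n = n} n≤m y =
  inject≤ y n≤m , trans (cong (_mod n) (Fin.toℕ-inject≤ y n≤m)) (mod-toℕ y)

allEdges⇒⪯ : ∀ {D E} → 0 < size D → AllEdges D → size D ≤ size E → D ⪯ E
allEdges⇒⪯ {D} 0<D all D≤E =
  (λ x → toℕ x mod size D) , (λ a b _ → all _ _) , mod-surjective D≤E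
  where instance _ = >-nonZero 0<D

Av-allEdges-size : ∀ {D} → 0 < size D → AllEdges D → ∀ E → Av D E → size E < size D
Av-allEdges-size {D} 0<D all E D⋠E with size D ℕ.≤? size E
... | yes D≤E = contradiction (allEdges⇒⪯ 0<D all D≤E) D⋠E
... | no  D≰E = ℕ.≰⇒> D≰E

complete⇒Av-finite : ∀ {D} → 0 < size D → IsComplete D → FiniteClass (Av D)
complete⇒Av-finite {D} 0<D complete =
  size-bounded⇒finite (size D) (Av-allEdges-size 0<D (complete⇒allEdges complete))

sized-antichain : ∀ {C} (adj : (k : ℕ) → Fin k → Fin k → Bool) (c : ℕ) →
  (∀ k → C (digraph k (adj k))) →
  (∀ {n m} → c ≤ n → n < m → ¬ (digraph n (adj n) ⪯ digraph m (adj m))) →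
  InfiniteAntichain C
sized-antichain adj c in-C incomparable =
  (λ i → digraph (i + c) (adj (i + c))) , (λ i → in-C (i + c)) , antichain
  where
  antichain : ∀ i j → i ≢ j → ¬ (digraph (i + c) (adj (i + c)) ⪯ digraph (j + c) (adj (j + c)))
  antichain i j i≢j with ℕ.<-cmp i j
  ... | tri< i<j _ _ = incomparable (ℕ.m≤n+m c i) (ℕ.+-monoˡ-< c i<j)
  ... | tri≈ _ i≡j _ = contradiction i≡j i≢j
  ... | tri> _ _ j<i = larger⇒⋠ {digraph (i + c) (adj (i + c))} (ℕ.+-monoˡ-< c j<i)

Kᵒ : ℕ → Digraph
Kᵒ m = digraph m λ a b → not (does (a ≟ b))

Kᵒ-edge : ∀ {m} {a b : Fin m} → a ≢ b → Edge (Kᵒ m) a b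
Kᵒ-edge {a = a} {b} a≢b = cong not (dec-false (a ≟ b) a≢b)

Kᵒ-loopless : ∀ {m} (a : Fin m) → ¬ Edge (Kᵒ m) a a
Kᵒ-loopless a loop with () ← trans (sym (cong not (dec-true (a ≟ a) refl))) loop

Kᵒ-⋠ : ∀ {n m} → n < m → ¬ (Kᵒ n ⪯ Kᵒ m)
Kᵒ-⋠ {n} n<m (f , f-hom , _) with x , y , x<y , fx≡fy ← Fin.pigeonhole n<m f =
  Kᵒ-loopless (f y)
    (subst (λ z → Edge (Kᵒ n) z (f y)) fx≡fy (f-hom x y (Kᵒ-edge (Fin.<⇒≢ x<y))))

Kᵒ∈Av : ∀ {D a b} → a ≢ b → ¬ Edge D a b → ∀ m → Av D (Kᵒ m)
Kᵒ∈Av {D} {a} {b} a≢b ¬ab m (f , f-hom , f-surj) with x , refl ← f-surj a with y , refl ← f-surj b =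
  ¬ab (f-hom x y (Kᵒ-edge λ x≡y → a≢b (cong f x≡y)))

IsAntisymmetric : Digraph → Set
IsAntisymmetric E = ∀ a b → Edge E a b → Edge E b a → a ≡ b

hom-kernel-closed : ∀ {D E f} → IsAntisymmetric E → IsHom D E f →
  ∀ {u v x} → f u ≡ f v → Edge D x u → Edge D v x → f x ≡ f u
hom-kernel-closed {E = E} {f} antisym f-hom {u} {v} {x} fu≡fv xu vx =
  antisym (f x) (f u) (f-hom x u xu) (subst (λ z → Edge E z (f x)) (sym fu≡fv) (f-hom v x vx))

infix 4 _⇝_ _⇝?_

_⇝_ : ℕ → ℕ → Set
i ⇝ j = j ≡ i ⊎ j ≡ suc i ⊎ 2 + j ≤ i

_⇝?_ : ∀ i j → Dec (i ⇝ j)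
i ⇝? j = j ℕ.≟ i ⊎-dec j ℕ.≟ suc i ⊎-dec 2 + j ℕ.≤? i

⇝-antisym : ∀ {i j} → i ⇝ j → j ⇝ i → i ≡ j
⇝-antisym (inj₁ refl)        _                  = refl
⇝-antisym _                  (inj₁ refl)        = refl
⇝-antisym (inj₂ (inj₁ refl)) (inj₂ (inj₁ ()))
⇝-antisym (inj₂ (inj₁ refl)) (inj₂ (inj₂ 2+i≤1+i)) = contradiction 2+i≤1+i ℕ.1+n≰n
⇝-antisym (inj₂ (inj₂ 2+j≤1+j)) (inj₂ (inj₁ refl)) = contradiction 2+j≤1+j ℕ.1+n≰n
⇝-antisym (inj₂ (inj₂ 2+j≤i)) (inj₂ (inj₂ 2+i≤j)) =
  contradiction (ℕ.<⇒≤ 2+i≤j) (ℕ.<-asym (ℕ.<⇒≤ 2+j≤i))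

T : ℕ → Digraph
T m = digraph m λ a b → does (toℕ a ⇝? toℕ b)

T-edge : ∀ {m} {a b : Fin m} → toℕ a ⇝ toℕ b → Edge (T m) a b
T-edge {a = a} {b} = dec-true (toℕ a ⇝? toℕ b)

Edge-T : ∀ {m} {a b : Fin m} → Edge (T m) a b → toℕ a ⇝ toℕ b
Edge-T {a = a} {b} e = toWitness (Equivalence.from T-≡ (trans (isYes≗does (toℕ a ⇝? toℕ b)) e))

T-antisymmetric : ∀ m → IsAntisymmetric (T m)
T-antisymmetric m a b ab ba = Fin.toℕ-injective (⇝-antisym (Edge-T ab) (Edge-T ba))

T∈Av : ∀ {D a} → ¬ Edge D a a → ∀ m → Av D (T m)
T∈Av {D} {a} ¬aa m (f , f-hom , f-surj) with x , refl ← f-surj a =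
  ¬aa (f-hom x x (T-edge {a = x} {x} (inj₁ refl)))

module TournamentCollapse {X : Set} (m : ℕ) (g : ℕ → X)
  (closed : ∀ {u v x} → u < m → v < m → x < m → g u ≡ g v → x ⇝ u → v ⇝ x → g x ≡ g u)
  where

  private
    below : ∀ {k} → suc k < m → k < m
    below = ℕ.<⇒≤

  step-up : ∀ {k} → 2 + k < m → g k ≡ g (1 + k) → g (1 + k) ≡ g (2 + k)
  step-up b e = trans (sym e)
    (sym (closed (below (below b)) (below b) b e (inj₂ (inj₂ ℕ.≤-refl)) (inj₂ (inj₁ refl))))

  step-down : ∀ {k} → 2 + k < m → g (1 + k) ≡ g (2 + k) → g k ≡ g (1 + k)
  step-down b e = closed (below b) b (below (below b)) e (inj₂ (inj₁ refl)) (inj₂ (inj₂ ℕ.≤-refl))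

  Adjacent : Set
  Adjacent = ∃[ k ] 1 + k < m × g k ≡ g (1 + k)

  adjacent-from-0 : g 0 ≡ g 1 → ∀ k → 1 + k < m → g k ≡ g (1 + k)
  adjacent-from-0 e zero    b = e
  adjacent-from-0 e (suc k) b = step-up b (adjacent-from-0 e k (below b))

  adjacent-to-0 : ∀ k → 1 + k < m → g k ≡ g (1 + k) → g 0 ≡ g 1
  adjacent-to-0 zero    b e = e
  adjacent-to-0 (suc k) b e = adjacent-to-0 k (below b) (step-down b e)

  adjacent⇒constant : Adjacent → ∀ z → z < m → g z ≡ g 0
  adjacent⇒constant _           zero    _ = refl
  adjacent⇒constant (k , b , e) (suc z) b′ =
    trans (sym (adjacent-from-0 (adjacent-to-0 k b e) z b′))
          (adjacent⇒constant (k , b , e) z (below b′))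

  gap⇒adjacent : 5 ≤ m → ∀ d u → d + suc u < m → g u ≡ g (d + suc u) → Adjacent
  gap⇒adjacent _ zero u b e = u , b , e
  gap⇒adjacent _ 1 u b e =
    suc u , b , closed b (below (below b)) (below b) (sym e) (inj₂ (inj₁ refl)) (inj₂ (inj₁ refl))
  -- The only use of 5 ≤ m: the collision of 0 and 3 is resolved through vertex 4.
  gap⇒adjacent 5≤m 2 zero b e =
    3 , 5≤m , trans (sym e) (sym (closed (ℕ.≤-trans (s≤s z≤n) 5≤m) b 5≤m e
                                          (inj₂ (inj₂ (s≤s (s≤s z≤n)))) (inj₂ (inj₁ refl))))
  gap⇒adjacent _ 2 (suc u) b e =
    u , 1+u<m , closed 1+u<m b (below 1+u<m) e
                       (inj₂ (inj₁ refl)) (inj₂ (inj₂ (s≤s (s≤s (ℕ.m≤n+m u 2)))))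
    where
    1+u<m : 1 + u < m
    1+u<m = below (below (below b))
  gap⇒adjacent 5≤m (suc (suc (suc d))) u b e =
    gap⇒adjacent 5≤m 1 u 2+u<m
      (sym (closed u<m b 2+u<m e (inj₂ (inj₂ ℕ.≤-refl)) (inj₂ (inj₂ 4+u≤w))))
    where
    4+u≤w : 4 + u ≤ 3 + (d + suc u)
    4+u≤w = s≤s (s≤s (s≤s (ℕ.m≤n+m (suc u) d)))
    2+u<m : 2 + u < m
    2+u<m = ℕ.<-trans (ℕ.<⇒≤ 4+u≤w) b
    u<m : u < m
    u<m = below (below 2+u<m)

  collision⇒adjacent : 5 ≤ m → ∀ {u w} → u < w → w < m → g u ≡ g w → Adjacent
  collision⇒adjacent 5≤m {u} u<w w<m e with d , refl ← ℕ.m≤n⇒∃[o]m+o≡n u<w =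
    gap⇒adjacent 5≤m d u (subst (_< m) comm w<m) (subst (λ w → g u ≡ g w) comm e)
    where
    comm : suc u + d ≡ d + suc u
    comm = ℕ.+-comm (suc u) d

constant⇒¬surjective : ∀ {m n} → 1 < n → (f : Fin m → Fin n) → (∀ a b → f a ≡ f b) → ¬ Surjective f
constant⇒¬surjective (s≤s (s≤s z≤n)) f constant surj
  with a , fa≡0 ← surj Fin.zero
  with b , fb≡1 ← surj (Fin.suc Fin.zero)
  with () ← trans (sym fa≡0) (trans (constant a b) fb≡1)

T-⋠ : ∀ {n m} → 5 ≤ n → n < m → ¬ (T n ⪯ T m)
T-⋠ {n} {m} 5≤n n<m (f , f-hom , f-surj) =
  constant⇒¬surjective (ℕ.≤-trans (s≤s (s≤s z≤n)) 5≤n) f f-constant f-surj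
  where
  instance _ = >-nonZero (ℕ.<-trans (ℕ.≤-trans (s≤s z≤n) 5≤n) n<m)

  -- f read along vertex indices; the values at indices ≥ m are junk and never used.
  g : ℕ → Fin n
  g k = f (k mod m)

  g-toℕ : ∀ a → g (toℕ a) ≡ f a
  g-toℕ a = cong f (mod-toℕ a)

  g-closed : ∀ {u v x} → u < m → v < m → x < m → g u ≡ g v → x ⇝ u → v ⇝ x → g x ≡ g u
  g-closed u<m v<m x<m gu≡gv x⇝u v⇝x =
    hom-kernel-closed {T m} {T n} {f} (T-antisymmetric n) f-hom gu≡gv
      (T-edge {m} (subst₂ _⇝_ (sym (toℕ-mod x<m)) (sym (toℕ-mod u<m)) x⇝u))
      (T-edge {m} (subst₂ _⇝_ (sym (toℕ-mod v<m)) (sym (toℕ-mod x<m)) v⇝x))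

  open TournamentCollapse m g g-closed

  adjacent : Adjacent
  adjacent with x , y , x<y , fx≡fy ← Fin.pigeonhole n<m f =
    collision⇒adjacent (ℕ.≤-trans 5≤n (ℕ.<⇒≤ n<m)) x<y (Fin.toℕ<n y)
      (trans (g-toℕ x) (trans fx≡fy (sym (g-toℕ y))))

  f-constant : ∀ a b → f a ≡ f b
  f-constant a b = begin
    f a          ≡⟨ g-toℕ a ⟨
    g (toℕ a)    ≡⟨ adjacent⇒constant adjacent (toℕ a) (Fin.toℕ<n a) ⟩
    g 0          ≡⟨ adjacent⇒constant adjacent (toℕ b) (Fin.toℕ<n b) ⟨
    g (toℕ b)    ≡⟨ g-toℕ b ⟩
    f b          ∎
    where open ≡-Reasoning

missing-edge⇒¬wqo : ∀ {D a b} → ¬ Edge D a b → ¬ IsWQO (Av D)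
missing-edge⇒¬wqo {D} {a} {b} ¬ab (_ , no-antichain) with a ≟ b
... | yes refl = no-antichain (sized-antichain {Av D} (edge ∘ T) 5 (T∈Av {D} ¬ab) T-⋠)
... | no  a≢b  = no-antichain (sized-antichain {Av D} (edge ∘ Kᵒ) 1 (Kᵒ∈Av {D} a≢b ¬ab) (λ _ → Kᵒ-⋠))

allEdges-or-missing : ∀ D → AllEdges D ⊎ ∃[ a ] ∃[ b ] ¬ Edge D a b
allEdges-or-missing D with Fin.any? (λ a → Fin.any? (λ b → ¬? (edge D a b ≟ᵇ true)))
... | yes (a , b , ¬ab) = inj₂ (a , b , ¬ab)
... | no  ¬missing      =
  inj₁ λ a b → decidable-stable (edge D a b ≟ᵇ true) (λ ¬ab → ¬missing (a , b , ¬ab))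

wqo⇒complete : ∀ {D} → IsWQO (Av D) → IsComplete D
wqo⇒complete {D} wqo with allEdges-or-missing D
... | inj₁ all              = allEdges⇒complete all
... | inj₂ (_ , _ , ¬ab)    = contradiction wqo (missing-edge⇒¬wqo {D} ¬ab)

theorem4p2 : (D : Digraph) → size D ≥ 1 →
    (IsWQO (Av D) ⇔ IsComplete D) × (IsComplete D → FiniteClass (Av D))
theorem4p2 D 0<D =
  mk⇔ wqo⇒complete (finite⇒wqo ∘ complete⇒Av-finite 0<D) , complete⇒Av-finite 0<D
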